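{- Let $A$ and $B$ be strings of lengths $n$ and $m$ with $m \le n$, over an alphabet together with the wildcard symbol $\mathsf{?}$, and let $k$ be the total number of wildcards occurring in $A$ and $B$ together. Assume $k \le m$ and that for every integer $d$ with $1 \le d < k$ the shifted matching sum of $B$ with shift $d$ is at least $3k$. Then for all integers $0 \le \alpha < \beta \le n-m$ with $\beta-\alpha < k$, either the number of mismatches between $A[\alpha, \alpha+m-1]$ and $B$ is at least $k/2$, or the number of mismatches between $A[\beta,\beta+m-1]$ and $B$ is at least $k/2$.
   Context: Strings are indexed from $0$; $X[\alpha,\beta]$ is the substring of $X$ from index $\alpha$ to $\beta$ inclusive. Two characters match if they are equal or at least one of them is the wildcard $\mathsf{?}$; otherwise they form a mismatch. For strings $X,Y$ of equal length, the number of mismatches between them is the number of indices $i$ such that $X_i$ does not match $Y_i$. For a shift $1 \le d < m$, the shifted matching array $\mathbb{S}(B,d)$ is the 0/1 array of length $m-d$ with $\mathbb{S}(B,d)_i = 0$ if $B_i = B_{i+d}$ and $B_i \neq \mathsf{?}$, and $\mathbb{S}(B,d)_i = 1$ otherwise (i.e. if $B_i=\mathsf{?}$ or $B_{i+d}=\mathsf{?}$ or $B_i \ne B_{i+d}$). The shifted matching sum of $B$ with shift $d$ is $\sum_{i=0}^{m-d-1}\mathbb{S}(B,d)_i$. -}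

module Defs where

open import Data.Nat using (ℕ; zero; suc; _+_; _*_; _∸_; _≤_; _<_)
open import Data.Nat.Properties using (≤-trans; +-monoʳ-<; m+n∸m≡n; ≤-refl)
open import Data.Maybe using (Maybe; just; nothing)
open import Data.Fin using (Fin; fromℕ<)
open import Data.Vec using (Vec; lookup)
open import Relation.Nullary using (yes; no)
open import Relation.Binary.Definitions using (DecidableEquality)
open import Relation.Binary.PropositionalEquality using (_≡_)

-- Characters over an alphabet Σ extended by the wildcard ?:
-- nothing = the wildcard ?, just a = the letter a.

module _ {Σ : Set} (_≟_ : DecidableEquality Σ) where

  mismatch : Maybe Σ → Maybe Σ → ℕ
  mismatch nothing  _        = 0
  mismatch (just _) nothing  = 0
  mismatch (just a) (just b) with a ≟ b
  ... | yes _ = 0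
  ... | no  _ = 1

  -- Entry of the shifted matching array S(B,d)_i:
  -- 0 if B_i = B_{i+d} and B_i ≠ ?, otherwise 1.
  shiftEntry : Maybe Σ → Maybe Σ → ℕ
  shiftEntry nothing  _        = 1
  shiftEntry (just _) nothing  = 1
  shiftEntry (just a) (just b) with a ≟ b
  ... | yes _ = 0
  ... | no  _ = 1


isWild : {Σ : Set} → Maybe Σ → ℕ
isWild nothing  = 1
isWild (just _) = 0

sumBelow : (t : ℕ) → ((i : ℕ) → i < t → ℕ) → ℕ
sumBelow zero    f = 0
sumBelow (suc t) f = sumBelow t (λ i i<t → f i (≤-trans i<t (Data.Nat.Properties.n≤1+n t))) + f t ≤-refl

module _ {Σ : Set} (_≟_ : DecidableEquality Σ) where

  wildcards : ∀ {n} → Vec (Maybe Σ) n → ℕ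
  wildcards {n} X = sumBelow n (λ i i<n → isWild (lookup X (fromℕ< i<n)))

  mismatchesAt : ∀ {n m} → Vec (Maybe Σ) n → Vec (Maybe Σ) m →
                 (α : ℕ) → α + m ≤ n → ℕ
  mismatchesAt {n} {m} A B α le =
    sumBelow m (λ i i<m →
      mismatch _≟_ (lookup A (fromℕ< (≤-trans (+-monoʳ-< α i<m) le)))
                   (lookup B (fromℕ< i<m)))

  shiftedMatchingSum : ∀ {m} → Vec (Maybe Σ) m → (d : ℕ) → d < m → ℕ
  shiftedMatchingSum {m} B d d<m =
    sumBelow (m ∸ d) (λ i i<m-d →
      shiftEntry _≟_ (lookup B (fromℕ< (idx i i<m-d)))
                     (lookup B (fromℕ< (idx' i i<m-d))))
    where
      open import Data.Nat.Properties using (m≤m+n; +-comm; m+[n∸m]≡n; <⇒≤; +-monoˡ-<)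
      open Relation.Binary.PropositionalEquality using (subst)
      bound : ∀ i → i < m ∸ d → i + d < m
      bound i lt = subst (λ z → i + d < z) (Data.Nat.Properties.m∸n+n≡m (<⇒≤ d<m)) (+-monoˡ-< d lt)
      idx : ∀ i → i < m ∸ d → i < m
      idx i lt = ≤-trans (Data.Nat.Properties.m≤m+n (suc i) d) (bound i lt)
      idx' : ∀ i → i < m ∸ d → i + d < m
      idx' = bound

-- Put d = β − α, so that A[α + d + i] = A[β + i]. If B_i and B_{i+d} do not form a 0 entry
-- of S(B,d), then one of them is a wildcard, or the common text character A[β + i] is a
-- wildcard, or A[β + i] mismatches B_i (a mismatch at shift β) or B_{i+d} (a mismatch at
-- shift α). Summing over i gives
--   3k ≤ shiftedMatchingSum B d ≤ 2k + mismatches(α) + mismatches(β),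
-- so one of the two mismatch counts is at least k/2.
module Submission where

open import Defs
open import Data.Nat using (ℕ; zero; suc; _+_; _*_; _∸_; _≤_; _<_; z≤n; s≤s; _≤?_)
open import Data.Nat.Properties
open import Data.Nat.Tactic.RingSolver using (solve-∀)
open import Data.Maybe using (Maybe; just; nothing; maybe′; fromMaybe; zipWith)
open import Data.Vec using (Vec; []; _∷_; lookup)
open import Data.Fin using (fromℕ<)
open import Data.Sum using (_⊎_; inj₁; inj₂)
open import Relation.Nullary using (yes; no; contradiction)
open import Relation.Binary.Definitions using (DecidableEquality)
open import Relation.Binary.PropositionalEquality

sumTo : ℕ → (ℕ → ℕ) → ℕ
sumTo zero    f = 0
sumTo (suc t) f = sumTo t f + f t

sumBelow≡sumTo : ∀ t {f} {g : ℕ → ℕ} → (∀ i (i<t : i < t) → f i i<t ≡ g i) →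
                 sumBelow t f ≡ sumTo t g
sumBelow≡sumTo zero    f≡g = refl
sumBelow≡sumTo (suc t) f≡g = cong₂ _+_ (sumBelow≡sumTo t (λ i _ → f≡g i _)) (f≡g t _)

sumTo-mono-≤ : ∀ t {f g : ℕ → ℕ} → (∀ i → i < t → f i ≤ g i) → sumTo t f ≤ sumTo t g
sumTo-mono-≤ zero    f≤g = z≤n
sumTo-mono-≤ (suc t) f≤g =
  +-mono-≤ (sumTo-mono-≤ t (λ i i<t → f≤g i (m≤n⇒m≤1+n i<t))) (f≤g t ≤-refl)

sumTo-+-≤ : ∀ t {f g : ℕ → ℕ} {a b} → sumTo t f ≤ a → sumTo t g ≤ b →
            sumTo t (λ i → f i + g i) ≤ a + b
sumTo-+-≤ zero    _  _  = z≤n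
sumTo-+-≤ (suc t) {f} {g} {a} {b} Σf≤a Σg≤b = begin
  sumTo t (λ i → f i + g i) + (f t + g t)       ≤⟨ +-monoˡ-≤ _ (sumTo-+-≤ t ≤-refl ≤-refl) ⟩
  (sumTo t f + sumTo t g) + (f t + g t)         ≡⟨ +-+-comm (sumTo t f) (sumTo t g) (f t) (g t) ⟩
  (sumTo t f + f t) + (sumTo t g + g t)         ≤⟨ +-mono-≤ Σf≤a Σg≤b ⟩
  a + b                                         ∎
  where
  open ≤-Reasoning
  +-+-comm : ∀ w x y z → (w + x) + (y + z) ≡ (w + y) + (x + z)
  +-+-comm = solve-∀

sumTo-split : ∀ c t f → sumTo (c + t) f ≡ sumTo c f + sumTo t (λ i → f (c + i))
sumTo-split c zero    f = trans (cong (λ s → sumTo s f) (+-identityʳ c)) (sym (+-identityʳ _))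
sumTo-split c (suc t) f rewrite +-suc c t | sumTo-split c t f =
  +-assoc (sumTo c f) (sumTo t (λ i → f (c + i))) (f (c + t))

sumTo-monoˡ-≤ : ∀ {s t} f → s ≤ t → sumTo s f ≤ sumTo t f
sumTo-monoˡ-≤ {s} {t} f s≤t = begin
  sumTo s f                                 ≤⟨ m≤m+n _ _ ⟩
  sumTo s f + sumTo (t ∸ s) (λ i → f (s + i)) ≡⟨ sym (sumTo-split s (t ∸ s) f) ⟩
  sumTo (s + (t ∸ s)) f                     ≡⟨ cong (λ u → sumTo u f) (m+[n∸m]≡n s≤t) ⟩
  sumTo t f                                 ∎
  where open ≤-Reasoning

sumTo-window-≤ : ∀ c t {u} f → c + t ≤ u → sumTo t (λ i → f (c + i)) ≤ sumTo u f
sumTo-window-≤ c t {u} f c+t≤u = begin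
  sumTo t (λ i → f (c + i))                 ≤⟨ m≤n+m _ _ ⟩
  sumTo c f + sumTo t (λ i → f (c + i))     ≡⟨ sym (sumTo-split c t f) ⟩
  sumTo (c + t) f                           ≤⟨ sumTo-monoˡ-≤ f c+t≤u ⟩
  sumTo u f                                 ∎
  where open ≤-Reasoning

lookup? : {A : Set} {n : ℕ} → Vec A n → ℕ → Maybe A
lookup? []       _       = nothing
lookup? (x ∷ xs) zero    = just x
lookup? (x ∷ xs) (suc j) = lookup? xs j

lookup?-fromℕ< : {A : Set} {n : ℕ} (X : Vec A n) {j : ℕ} (j<n : j < n) →
                 lookup? X j ≡ just (lookup X (fromℕ< j<n))
lookup?-fromℕ< (x ∷ X) {zero}  _         = refl
lookup?-fromℕ< (x ∷ X) {suc j} (s≤s j<n) = lookup?-fromℕ< X j<n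

m+m≡2*m : ∀ m → m + m ≡ 2 * m
m+m≡2*m = solve-∀

m≤n+o⇒m≤2*n⊎m≤2*o : ∀ {m} n o → m ≤ n + o → m ≤ 2 * n ⊎ m ≤ 2 * o
m≤n+o⇒m≤2*n⊎m≤2*o n o m≤n+o with n ≤? o
... | yes n≤o = inj₂ (≤-trans m≤n+o (≤-trans (+-monoˡ-≤ o n≤o) (≤-reflexive (m+m≡2*m o))))
... | no  n≰o = inj₁ (≤-trans m≤n+o (≤-trans (+-monoʳ-≤ n (<⇒≤ (≰⇒> n≰o))) (≤-reflexive (m+m≡2*m n))))

module _ {Σ : Set} (_≟_ : DecidableEquality Σ) where

  shiftEntry≤wildcards+mismatches : ∀ a b c →
    shiftEntry _≟_ b c ≤ isWild b + isWild c + isWild a + mismatch _≟_ a b + mismatch _≟_ a c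
  shiftEntry≤wildcards+mismatches a        nothing  c        = s≤s z≤n
  shiftEntry≤wildcards+mismatches a        (just b) nothing  = s≤s z≤n
  shiftEntry≤wildcards+mismatches nothing  (just b) (just c) with b ≟ c
  ... | yes _ = z≤n
  ... | no  _ = s≤s z≤n
  shiftEntry≤wildcards+mismatches (just a) (just b) (just c) with b ≟ c
  ... | yes _ = z≤n
  ... | no b≢c with a ≟ b | a ≟ c
  ...   | yes a≡b | yes a≡c = contradiction (trans (sym a≡b) a≡c) b≢c
  ...   | yes _   | no  _   = s≤s z≤n
  ...   | no  _   | _       = ≤-trans (s≤s z≤n) (m≤m+n 1 _)

  -- Per-position counts as total functions of a natural-number index (0 outside the
  -- strings), so that sums over index windows can be shifted and split freely.
  lift₂ : (Maybe Σ → Maybe Σ → ℕ) → Maybe (Maybe Σ) → Maybe (Maybe Σ) → ℕ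
  lift₂ f x y = fromMaybe 0 (zipWith f x y)

  wildAt : ∀ {n} → Vec (Maybe Σ) n → ℕ → ℕ
  wildAt X i = maybe′ isWild 0 (lookup? X i)

  mismatchAt : ∀ {n m} → Vec (Maybe Σ) n → Vec (Maybe Σ) m → ℕ → ℕ → ℕ
  mismatchAt A B α i = lift₂ (mismatch _≟_) (lookup? A (α + i)) (lookup? B i)

  shiftEntryAt : ∀ {m} → Vec (Maybe Σ) m → ℕ → ℕ → ℕ
  shiftEntryAt B d i = lift₂ (shiftEntry _≟_) (lookup? B i) (lookup? B (d + i))

  wildcards≡sumTo : ∀ {n} (X : Vec (Maybe Σ) n) → wildcards _≟_ X ≡ sumTo n (wildAt X)
  wildcards≡sumTo {n} X =
    sumBelow≡sumTo n (λ i i<n → cong (maybe′ isWild 0) (sym (lookup?-fromℕ< X i<n)))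

  mismatchesAt≡sumTo : ∀ {n m} (A : Vec (Maybe Σ) n) (B : Vec (Maybe Σ) m) α (hα : α + m ≤ n) →
                       mismatchesAt _≟_ A B α hα ≡ sumTo m (mismatchAt A B α)
  mismatchesAt≡sumTo {m = m} A B α hα = sumBelow≡sumTo m λ i i<m →
    cong₂ (lift₂ (mismatch _≟_))
          (sym (lookup?-fromℕ< A (≤-trans (+-monoʳ-< α i<m) hα)))
          (sym (lookup?-fromℕ< B i<m))

  shiftedMatchingSum≡sumTo : ∀ {m} (B : Vec (Maybe Σ) m) d (d<m : d < m) →
                             shiftedMatchingSum _≟_ B d d<m ≡ sumTo (m ∸ d) (shiftEntryAt B d)
  shiftedMatchingSum≡sumTo {m} B d d<m = sumBelow≡sumTo (m ∸ d) λ i i<m∸d →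
    let i+d<m = subst (i + d <_) (m∸n+n≡m (<⇒≤ d<m)) (+-monoˡ-< d i<m∸d) in
    cong₂ (lift₂ (shiftEntry _≟_))
          (sym (lookup?-fromℕ< B (≤-trans (s≤s (m≤m+n i d)) i+d<m)))
          (sym (trans (cong (lookup? B) (+-comm d i)) (lookup?-fromℕ< B i+d<m)))

  shiftEntryAt≤wildcards+mismatches :
    ∀ {a b c} x w y z → x ≡ just a → w ≡ just a → y ≡ just b → z ≡ just c →
    lift₂ (shiftEntry _≟_) y z ≤
      maybe′ isWild 0 y + maybe′ isWild 0 z + maybe′ isWild 0 x
      + lift₂ (mismatch _≟_) x y + lift₂ (mismatch _≟_) w z
  shiftEntryAt≤wildcards+mismatches {a} {b} {c} _ _ _ _ refl refl refl refl =
    shiftEntry≤wildcards+mismatches a b c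

  shiftedMatchingSum≤wildcards+mismatches :
    ∀ {n m} (A : Vec (Maybe Σ) n) (B : Vec (Maybe Σ) m) {α β d} → α + d ≡ β →
    (d<m : d < m) (hα : α + m ≤ n) (hβ : β + m ≤ n) →
    shiftedMatchingSum _≟_ B d d<m ≤
      2 * (wildcards _≟_ A + wildcards _≟_ B)
      + (mismatchesAt _≟_ A B α hα + mismatchesAt _≟_ A B β hβ)
  shiftedMatchingSum≤wildcards+mismatches {n} {m} A B {α} {β} {d} α+d≡β d<m hα hβ = begin
    shiftedMatchingSum _≟_ B d d<m
      ≡⟨ shiftedMatchingSum≡sumTo B d d<m ⟩
    sumTo t (shiftEntryAt B d)
      ≤⟨ sumTo-mono-≤ t pointwise ⟩
    sumTo t (λ i → wildAt B i + wildAt B (d + i) + wildAt A (β + i)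
                   + mismatchAt A B β i + mismatchAt A B α (d + i))
      ≤⟨ sumTo-+-≤ t (sumTo-+-≤ t (sumTo-+-≤ t (sumTo-+-≤ t
           (sumTo-window-≤ 0 t (wildAt B) t≤m)
           (sumTo-window-≤ d t (wildAt B) d+t≤m))
           (sumTo-window-≤ β t (wildAt A) β+t≤n))
           (sumTo-window-≤ 0 t (mismatchAt A B β) t≤m))
           (sumTo-window-≤ d t (mismatchAt A B α) d+t≤m) ⟩
    wB + wB + wA + mβ + mα
      ≤⟨ regroup wA wB mα mβ ⟩
    2 * (wA + wB) + (mα + mβ)
      ≡⟨ sym (cong₂ (λ w μ → 2 * w + μ)
               (cong₂ _+_ (wildcards≡sumTo A) (wildcards≡sumTo B))
               (cong₂ _+_ (mismatchesAt≡sumTo A B α hα) (mismatchesAt≡sumTo A B β hβ))) ⟩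
    2 * (wildcards _≟_ A + wildcards _≟_ B)
      + (mismatchesAt _≟_ A B α hα + mismatchesAt _≟_ A B β hβ)
      ∎
    where
    open ≤-Reasoning
    t = m ∸ d
    wA = sumTo n (wildAt A)
    wB = sumTo m (wildAt B)
    mα = sumTo m (mismatchAt A B α)
    mβ = sumTo m (mismatchAt A B β)
    t≤m : t ≤ m
    t≤m = m∸n≤m m d
    d+t≤m : d + t ≤ m
    d+t≤m = ≤-reflexive (m+[n∸m]≡n (<⇒≤ d<m))
    β+t≤n : β + t ≤ n
    β+t≤n = ≤-trans (+-monoʳ-≤ β t≤m) hβ
    pointwise : ∀ i → i < t →
      shiftEntryAt B d i ≤ wildAt B i + wildAt B (d + i) + wildAt A (β + i)
                           + mismatchAt A B β i + mismatchAt A B α (d + i)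
    pointwise i i<t = shiftEntryAt≤wildcards+mismatches _ _ _ _
      eqA (trans (cong (lookup? A) α+[d+i]≡β+i) eqA)
      (lookup?-fromℕ< B i<m)
      (lookup?-fromℕ< B (<-≤-trans (+-monoʳ-< d i<t) d+t≤m))
      where
      i<m = <-≤-trans i<t t≤m
      eqA = lookup?-fromℕ< A (<-≤-trans (+-monoʳ-< β i<t) β+t≤n)
      α+[d+i]≡β+i : α + (d + i) ≡ β + i
      α+[d+i]≡β+i = trans (sym (+-assoc α d i)) (cong (_+ i) α+d≡β)
    regroup : ∀ a b x y → b + b + a + y + x ≤ 2 * (a + b) + (x + y)
    regroup a b x y = ≤-trans (m≤n+m _ a) (≤-reflexive (regroup≡ a b x y))
      where
      regroup≡ : ∀ a b x y → a + (b + b + a + y + x) ≡ 2 * (a + b) + (x + y)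
      regroup≡ = solve-∀

lemma1 : {Σ : Set} (_≟_ : DecidableEquality Σ) (n m : ℕ)
         (A : Vec (Maybe Σ) n) (B : Vec (Maybe Σ) m) →
         m ≤ n →
         let k = wildcards _≟_ A + wildcards _≟_ B in
         k ≤ m →
         ((d : ℕ) (d≥1 : 1 ≤ d) (d<k : d < k) (d<m : d < m) →
           3 * k ≤ shiftedMatchingSum _≟_ B d d<m) →
         (α β : ℕ) (α<β : α < β) (β≤ : β ≤ n ∸ m) (hα : α + m ≤ n) (hβ : β + m ≤ n) →
         β ∸ α < k →
         k ≤ 2 * mismatchesAt _≟_ A B α hα ⊎ k ≤ 2 * mismatchesAt _≟_ A B β hβ
lemma1 _≟_ n m A B _ k≤m 3k≤S α β α<β _ hα hβ d<k =
  m≤n+o⇒m≤2*n⊎m≤2*o mα mβ (+-cancelˡ-≤ (2 * k) k (mα + mβ) (begin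
    2 * k + k                       ≡⟨ 2k+k≡3k k ⟩
    3 * k                           ≤⟨ 3k≤S d (m<n⇒0<n∸m α<β) d<k d<m ⟩
    shiftedMatchingSum _≟_ B d d<m  ≤⟨ shiftedMatchingSum≤wildcards+mismatches _≟_ A B α+d≡β d<m hα hβ ⟩
    2 * k + (mα + mβ)               ∎))
  where
  open ≤-Reasoning
  k = wildcards _≟_ A + wildcards _≟_ B
  mα = mismatchesAt _≟_ A B α hα
  mβ = mismatchesAt _≟_ A B β hβ
  d = β ∸ α
  α+d≡β = m+[n∸m]≡n (<⇒≤ α<β)
  d<m = <-≤-trans d<k k≤m
  2k+k≡3k : ∀ k → 2 * k + k ≡ 3 * k
  2k+k≡3k = solve-∀
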